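{- Let $\mathcal{G}=(G_1,\dots,G_T)$ be an always $S$-connected temporal graph on $n$ vertices, let $m=|S|$, and let $\Delta$ be the average degree of its underlying graph. Let $X\subseteq V$ with $|X|\ge m+1$, and suppose $T\ge 2\Delta n/(|X|-(m-1))+1$. Then there exist two distinct vertices $v,u\in X$ such that there is a temporal walk in $\mathcal{G}$ starting at $v$ and ending at $u$.
   Context: A temporal graph $\mathcal{G}=(G_1,\dots,G_T)$ on a vertex set $V$, $|V|=n$, is a sequence of simple undirected graphs $G_t=(V,E_t)$. Its underlying graph is $U=(V,\bigcup_t E_t)$, with average degree $\Delta=\frac1n\sum_v\deg_U(v)$. It is always $S$-connected if for every $t$ and every $v\in V$ some $u\in S$ is joined to $v$ by a path in $G_t$. A temporal walk from $v_0$ to $v_\ell$ is a sequence $((v_0,v_1),t_1),\dots,((v_{\ell-1},v_\ell),t_\ell)$ with $\{v_{j-1},v_j\}\in E_{t_j}$ and $1\le t_1<\dots<t_\ell\le T$. -}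

module Defs where

open import Data.Nat using (ℕ; zero; suc; _+_; _*_; _≤_)
open import Data.Bool using (Bool; true; false; if_then_else_)
open import Data.Fin using (Fin; toℕ)
open import Data.List using (List; map; allFin)
open import Data.Nat.ListAction using (sum)
open import Data.Bool.ListAction using (any)
open import Data.Product using (Σ; _×_; ∃)
open import Relation.Binary.PropositionalEquality using (_≡_)
open import Relation.Nullary using (¬_)
open import Data.Fin.Subset using (Subset; _∈_)

-- A temporal graph on vertex set Fin n with lifetime T.
-- Snapshot index t : Fin T stands for time step (toℕ t + 1) ∈ {1,…,T}.
-- Each snapshot is a simple undirected graph (symmetric, loopless).
record TemporalGraph (n T : ℕ) : Set where
  field
    adj    : Fin T → Fin n → Fin n → Bool
    sym    : ∀ t u v → adj t u v ≡ adj t v u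
    irrefl : ∀ t v → adj t v v ≡ false
open TemporalGraph public

underlyingAdj : ∀ {n T} → TemporalGraph n T → Fin n → Fin n → Bool
underlyingAdj {T = T} G u v = any (λ t → adj G t u v) (allFin T)

degU : ∀ {n T} → TemporalGraph n T → Fin n → ℕ
degU {n} G v = sum (map (λ u → if underlyingAdj G v u then 1 else 0) (allFin n))

-- Σ_v deg_U(v)  ( = Δ · n ).
degSum : ∀ {n T} → TemporalGraph n T → ℕ
degSum {n} G = sum (map (degU G) (allFin n))

data Reach {n T} (G : TemporalGraph n T) (t : Fin T) : Fin n → Fin n → Set where
  here : ∀ {v} → Reach G t v v
  step : ∀ {u w v} → adj G t u w ≡ true → Reach G t w v → Reach G t u v

AlwaysConnected : ∀ {n T} → TemporalGraph n T → Subset n → Set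
AlwaysConnected {n} {T} G S = ∀ (t : Fin T) (v : Fin n) → ∃ λ u → u ∈ S × Reach G t u v

-- Temporal walks from v to u all of whose time labels are ≥ lb (as Fin indices),
-- with strictly increasing time labels.
data TWalkFrom {n T} (G : TemporalGraph n T) : ℕ → Fin n → Fin n → Set where
  nil  : ∀ {lb v} → TWalkFrom G lb v v
  cons : ∀ {lb v w u} (t : Fin T) → lb ≤ toℕ t → adj G t v w ≡ true →
         TWalkFrom G (suc (toℕ t)) w u → TWalkFrom G lb v u

TemporalWalk : ∀ {n T} → TemporalGraph n T → Fin n → Fin n → Set
TemporalWalk G v u = TWalkFrom G 0 v u

{-# OPTIONS --safe #-}
module Submission where

-- Suppose no temporal walk joins two distinct vertices of X. At time t, a vertex x ∈ X
-- claims a if x reaches a using times before t and a reaches x using times after t; no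
-- vertex is claimed twice, since the two journeys would join distinct vertices of X.
-- A vertex is in transition at t if it is first reached from X, or last able to reach X,
-- at time t; this happens at most twice per vertex. If x shares its component of G_t with
-- another vertex of X, the connecting path leaves the region claimed by x along an edge
-- of G_t into a vertex in transition. Charging x to that edge of U, at most
-- Σ_b deg_U(b)·[b in transition at t] vertices of X are charged at time t, hence at most
-- 2Δn over all times. On the other hand the uncharged vertices of X, together with one
-- charged vertex, lie in distinct components of G_t, each of which meets S; so at least
-- |X| + 1 − |S| vertices are charged at every time, and T(|X| + 1 − |S|) ≤ 2Δn.

open import Defs hiding (sym)
open import Data.Nat using (ℕ; zero; suc; _+_; _*_; _∸_; _≤_; _<_; z≤n; s≤s)
open import Data.Nat.Properties
  using ( ≤-refl; ≤-reflexive; ≤-trans; <⇒≤; <⇒≱; >⇒≢; ≮⇒≥; _<?_; module ≤-Reasoning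
        ; +-comm; +-assoc; +-suc; +-identityʳ; *-comm; *-identityˡ; +-*-semiring
        ; +-mono-≤; +-monoʳ-≤; *-mono-≤; *-monoˡ-≤; *-monoʳ-≤; +-cancelʳ-<
        ; m≤m+n; m≤n+m; n≤1+n; m≤n⇒m≤1+n; m<m+n
        ; +-∸-assoc; m≤n⇒m∸n≡0; m+[n∸m]≡n; m≤n+o⇒m∸n≤o; m<n⇒0<n∸m )
import Data.Nat.Properties as ℕₚ
import Data.Nat.ListAction as ℕ
open import Data.Bool using (true; false; if_then_else_)
import Data.Bool.Properties as Boolₚ
open import Data.Fin using (Fin; zero; suc; toℕ)
import Data.Fin.Properties as Finₚ
open Finₚ using (any?)
open import Data.Fin.Subset using (Subset; _∈_; ∣_∣)
open import Data.Fin.Subset.Properties using (_∈?_)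
import Data.List as List
import Data.List.Properties as Listₚ
import Data.List.Relation.Unary.Any as Any
open import Data.List.Relation.Unary.Any.Properties using (any⁺)
open import Data.List.Membership.Propositional.Properties using (∈-allFin)
open import Data.Product using (∃; ∃₂; ∃-syntax; _×_; _,_; proj₁; proj₂)
open import Data.Sum using (_⊎_; inj₁; inj₂)
open import Data.Vec using ([]; _∷_)
open import Function using (_∘_; Equivalence)
open import Relation.Binary.PropositionalEquality
  using (_≡_; _≢_; refl; cong; sym; trans; subst; module ≡-Reasoning)
open import Relation.Nullary using (Dec; does; yes; no; ¬_; ¬?; _×-dec_; _⊎-dec_; contradiction)
open import Relation.Unary using (Pred; Decidable)
open import Algebra.Properties.Semiring.Sum +-*-semiring
  using (sum-syntax; sum-cong-≗; ∑-distrib-+; ∑-comm; *-distribˡ-sum; *-distribʳ-sum)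

𝟙 : ∀ {p} {P : Set p} → Dec P → ℕ
𝟙 P? = if does P? then 1 else 0

𝟙≤1 : ∀ {p} {P : Set p} (P? : Dec P) → 𝟙 P? ≤ 1
𝟙≤1 (yes _) = ≤-refl
𝟙≤1 (no _)  = z≤n

1≤𝟙 : ∀ {p} {P : Set p} (P? : Dec P) → P → 1 ≤ 𝟙 P?
1≤𝟙 (yes _) _  = ≤-refl
1≤𝟙 (no ¬p) p = contradiction p ¬p

𝟙≤ : ∀ {p} {P : Set p} {k} (P? : Dec P) → (P → 1 ≤ k) → 𝟙 P? ≤ k
𝟙≤ (yes p) 1≤k = 1≤k p
𝟙≤ (no _)  _   = z≤n

𝟙-⊎ : ∀ {p q} {P : Set p} {Q : Set q} (P? : Dec P) (Q? : Dec Q) → 𝟙 (P? ⊎-dec Q?) ≤ 𝟙 P? + 𝟙 Q?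
𝟙-⊎ (yes _) _ = s≤s z≤n
𝟙-⊎ (no _)  _ = ≤-refl

𝟙-⊎-disjoint : ∀ {p q} {P : Set p} {Q : Set q} (P? : Dec P) (Q? : Dec Q) →
               ¬ (P × Q) → 𝟙 (P? ⊎-dec Q?) ≡ 𝟙 P? + 𝟙 Q?
𝟙-⊎-disjoint (yes p) (yes q) ¬pq = contradiction (p , q) ¬pq
𝟙-⊎-disjoint (yes _) (no _)  _   = refl
𝟙-⊎-disjoint (no _)  _       _   = refl

𝟙-split : ∀ {p q} {P : Set p} {Q : Set q} (P? : Dec P) (Q? : Dec Q) →
          𝟙 P? ≡ 𝟙 (P? ×-dec Q?) + 𝟙 (P? ×-dec ¬? Q?)
𝟙-split (yes _) (yes _) = refl
𝟙-split (yes _) (no _)  = refl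
𝟙-split (no _)  _       = refl

∑-mono-≤ : ∀ {n} {f g : Fin n → ℕ} → (∀ i → f i ≤ g i) → ∑[ i < n ] f i ≤ ∑[ i < n ] g i
∑-mono-≤ {zero}  _   = z≤n
∑-mono-≤ {suc n} f≤g = +-mono-≤ (f≤g zero) (∑-mono-≤ (f≤g ∘ suc))

∑-lowerBound : ∀ {n k} {f : Fin n → ℕ} → (∀ i → k ≤ f i) → n * k ≤ ∑[ i < n ] f i
∑-lowerBound {zero}  _   = z≤n
∑-lowerBound {suc n} k≤f = +-mono-≤ (k≤f zero) (∑-lowerBound (k≤f ∘ suc))

∑-single : ∀ {n} (f : Fin n → ℕ) (i : Fin n) → f i ≤ ∑[ j < n ] f j
∑-single f zero    = m≤m+n _ _
∑-single f (suc i) = ≤-trans (∑-single (f ∘ suc) i) (m≤n+m _ _)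

∑𝟙-none : ∀ {n p} {P : Pred (Fin n) p} (P? : Decidable P) → (∀ i → ¬ P i) → ∑[ i < n ] 𝟙 (P? i) ≡ 0
∑𝟙-none {zero}  P? ∄P = refl
∑𝟙-none {suc n} P? ∄P with P? zero
... | yes p = contradiction p (∄P zero)
... | no _  = ∑𝟙-none (P? ∘ suc) (∄P ∘ suc)

∑𝟙-witness : ∀ {n p} {P : Pred (Fin n) p} (P? : Decidable P) → 1 ≤ ∑[ i < n ] 𝟙 (P? i) → ∃ P
∑𝟙-witness P? 1≤∑ with any? P?
... | yes ∃P = ∃P
... | no ∄P  = contradiction (∑𝟙-none P? (λ i p → ∄P (i , p))) (>⇒≢ 1≤∑)

∑𝟙-unique : ∀ {n p} {P : Pred (Fin n) p} (P? : Decidable P) →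
            (∀ {i j} → P i → P j → i ≡ j) → ∑[ i < n ] 𝟙 (P? i) ≤ 1
∑𝟙-unique {zero}  P? unique = z≤n
∑𝟙-unique {suc n} P? unique with P? zero
... | yes p = ≤-reflexive (cong suc (∑𝟙-none (P? ∘ suc) (λ i q → Finₚ.0≢1+n (unique p q))))
... | no _  = ∑𝟙-unique (P? ∘ suc) (λ p q → Finₚ.suc-injective (unique p q))

∑𝟙-owners : ∀ {n m p r} {P : Pred (Fin n) p} {R : Fin n → Fin m → Set r}
             (P? : Decidable P) (R? : ∀ x a → Dec (R x a)) (h : Fin m → ℕ) →
             (∀ {x} → P x → ∃[ a ] R x a × 1 ≤ h a) →
             (∀ {x y a} → P x → P y → R x a → R y a → x ≡ y) →
             ∑[ x < n ] 𝟙 (P? x) ≤ ∑[ a < m ] h a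
∑𝟙-owners {n} {m} {P = P} {R} P? R? h owns unique = begin
  ∑[ x < n ] 𝟙 (P? x)                             ≤⟨ ∑-mono-≤ owned ⟩
  ∑[ x < n ] ∑[ a < m ] (𝟙 (owner? a x) * h a)     ≡⟨ ∑-comm (λ x a → 𝟙 (owner? a x) * h a) ⟩
  ∑[ a < m ] ∑[ x < n ] (𝟙 (owner? a x) * h a)     ≡⟨ sum-cong-≗ (λ a → sym (*-distribʳ-sum (h a) (𝟙 ∘ owner? a))) ⟩
  ∑[ a < m ] ((∑[ x < n ] 𝟙 (owner? a x)) * h a)   ≤⟨ ∑-mono-≤ (λ a → *-monoˡ-≤ (h a) (owners≤1 a)) ⟩
  ∑[ a < m ] (1 * h a)                            ≡⟨ sum-cong-≗ (λ a → *-identityˡ (h a)) ⟩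
  ∑[ a < m ] h a                                  ∎
  where
  open ≤-Reasoning
  owner? : ∀ a x → Dec (P x × R x a)
  owner? a x = P? x ×-dec R? x a
  owned : ∀ x → 𝟙 (P? x) ≤ ∑[ a < m ] (𝟙 (owner? a x) * h a)
  owned x = 𝟙≤ (P? x) λ px → let a , rxa , 1≤ha = owns px in
    ≤-trans (*-mono-≤ (1≤𝟙 (owner? a x) (px , rxa)) 1≤ha) (∑-single (λ a → 𝟙 (owner? a x) * h a) a)
  owners≤1 : ∀ a → ∑[ x < n ] 𝟙 (owner? a x) ≤ 1
  owners≤1 a = ∑𝟙-unique (owner? a) (λ (px , rxa) (py , rya) → unique px py rxa rya)

∑-rises≤𝟙 : ∀ {p} {P : Pred ℕ p} (P? : Decidable P) → (∀ {t} → P t → P (suc t)) →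
            ∀ N → ∑[ i < N ] 𝟙 (P? (suc (toℕ i)) ×-dec ¬? (P? (toℕ i))) ≤ 𝟙 (¬? (P? 0))
∑-rises≤𝟙 P? mono zero    = z≤n
∑-rises≤𝟙 {P = P} P? mono (suc N) =
  ≤-trans (+-monoʳ-≤ _ (∑-rises≤𝟙 (P? ∘ suc) mono N)) (first-rise (P? 0) (P? 1))
  where
  first-rise : (P₀? : Dec (P 0)) (P₁? : Dec (P 1)) → 𝟙 (P₁? ×-dec ¬? P₀?) + 𝟙 (¬? P₁?) ≤ 𝟙 (¬? P₀?)
  first-rise (yes _)  (yes _)  = z≤n
  first-rise (yes p₀) (no ¬p₁) = contradiction (mono p₀) ¬p₁
  first-rise (no _)   (yes _)  = ≤-refl
  first-rise (no _)   (no _)   = ≤-refl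

∑-falls≤𝟙 : ∀ {p} {P : Pred ℕ p} (P? : Decidable P) → (∀ {t} → P (suc t) → P t) →
            ∀ N → ∑[ i < N ] 𝟙 (P? (toℕ i) ×-dec ¬? (P? (suc (toℕ i)))) ≤ 𝟙 (P? 0)
∑-falls≤𝟙 P? anti zero    = z≤n
∑-falls≤𝟙 {P = P} P? anti (suc N) =
  ≤-trans (+-monoʳ-≤ _ (∑-falls≤𝟙 (P? ∘ suc) anti N)) (first-fall (P? 0) (P? 1))
  where
  first-fall : (P₀? : Dec (P 0)) (P₁? : Dec (P 1)) → 𝟙 (P₀? ×-dec ¬? P₁?) + 𝟙 P₁? ≤ 𝟙 P₀?
  first-fall (yes _)  (yes _)  = ≤-refl
  first-fall (yes _)  (no _)   = ≤-refl
  first-fall (no _)   (no _)   = ≤-refl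
  first-fall (no ¬p₀) (yes p₁) = contradiction (anti p₁) ¬p₀

∣p∣≡∑𝟙∈p : ∀ {n} (p : Subset n) → ∣ p ∣ ≡ ∑[ x < n ] 𝟙 (x ∈? p)
∣p∣≡∑𝟙∈p []          = refl
∣p∣≡∑𝟙∈p (true ∷ p)  = cong suc (∣p∣≡∑𝟙∈p p)
∣p∣≡∑𝟙∈p (false ∷ p) = ∣p∣≡∑𝟙∈p p

∑𝟙-injection : ∀ {n m q} {Q : Pred (Fin n) q} (Q? : Decidable Q) (S : Subset m) (σ : Fin n → Fin m) →
                (∀ {x} → Q x → σ x ∈ S) → (∀ {x y} → Q x → Q y → σ x ≡ σ y → x ≡ y) →
                ∑[ x < n ] 𝟙 (Q? x) ≤ ∣ S ∣
∑𝟙-injection Q? S σ σ∈S injective = ≤-trans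
  (∑𝟙-owners Q? (λ x s → σ x Finₚ.≟ s) (λ s → 𝟙 (s ∈? S))
    (λ qx → σ _ , refl , 1≤𝟙 (σ _ ∈? S) (σ∈S qx))
    (λ qx qy σx≡s σy≡s → injective qx qy (trans σx≡s (sym σy≡s))))
  (≤-reflexive (sym (∣p∣≡∑𝟙∈p S)))

module Crowding {n c} (X S : Subset n) (σ : Fin n → Fin n) {C : Pred (Fin n) c} (C? : Decidable C)
  (σ∈S : ∀ x → σ x ∈ S) (alone : ∀ {x y} → x ∈ X → y ∈ X → ¬ C x → σ x ≡ σ y → x ≡ y) where

  Lonely : Pred (Fin n) c
  Lonely x = x ∈ X × ¬ C x

  lonely? : Decidable Lonely
  lonely? x = x ∈? X ×-dec ¬? (C? x)

  crowded? : Decidable (λ x → x ∈ X × C x)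
  crowded? x = x ∈? X ×-dec C? x

  #lonely #crowded : ℕ
  #lonely  = ∑[ x < n ] 𝟙 (lonely? x)
  #crowded = ∑[ x < n ] 𝟙 (crowded? x)

  ∣X∣≡#crowded+#lonely : ∣ X ∣ ≡ #crowded + #lonely
  ∣X∣≡#crowded+#lonely = trans (∣p∣≡∑𝟙∈p X)
    (trans (sum-cong-≗ (λ x → 𝟙-split (x ∈? X) (C? x))) (∑-distrib-+ (𝟙 ∘ crowded?) (𝟙 ∘ lonely?)))

  #lonely≤∣S∣ : #lonely ≤ ∣ S ∣
  #lonely≤∣S∣ = ∑𝟙-injection lonely? S σ (λ _ → σ∈S _) (λ (x∈X , ¬Cx) (y∈X , _) → alone x∈X y∈X ¬Cx)

  -- σ stays injective when one crowded vertex is added to the lonely ones.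
  crowded⇒#lonely+1≤∣S∣ : ∀ {x₀} → x₀ ∈ X → C x₀ → #lonely + 1 ≤ ∣ S ∣
  crowded⇒#lonely+1≤∣S∣ {x₀} x₀∈X Cx₀ = begin
    #lonely + 1                                  ≤⟨ +-monoʳ-≤ #lonely x₀-counted ⟩
    #lonely + ∑[ x < n ] 𝟙 (x Finₚ.≟ x₀)          ≡⟨ ∑-distrib-+ (𝟙 ∘ lonely?) (λ x → 𝟙 (x Finₚ.≟ x₀)) ⟨
    ∑[ x < n ] (𝟙 (lonely? x) + 𝟙 (x Finₚ.≟ x₀)) ≡⟨ sum-cong-≗ (λ x → 𝟙-⊎-disjoint (lonely? x) (x Finₚ.≟ x₀) ¬lonely-x₀) ⟨
    ∑[ x < n ] 𝟙 (lonely? x ⊎-dec x Finₚ.≟ x₀)   ≤⟨ ∑𝟙-injection (λ x → lonely? x ⊎-dec x Finₚ.≟ x₀) S σ (λ _ → σ∈S _) injective ⟩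
    ∣ S ∣                                        ∎
    where
    open ≤-Reasoning
    x₀-counted : 1 ≤ ∑[ x < n ] 𝟙 (x Finₚ.≟ x₀)
    x₀-counted = ≤-trans (1≤𝟙 (x₀ Finₚ.≟ x₀) refl) (∑-single (λ x → 𝟙 (x Finₚ.≟ x₀)) x₀)
    ¬lonely-x₀ : ∀ {x} → ¬ (Lonely x × x ≡ x₀)
    ¬lonely-x₀ ((_ , ¬Cx₀) , refl) = ¬Cx₀ Cx₀
    ∈X : ∀ {x} → Lonely x ⊎ x ≡ x₀ → x ∈ X
    ∈X (inj₁ (x∈X , _)) = x∈X
    ∈X (inj₂ refl)      = x₀∈X
    injective : ∀ {x y} → Lonely x ⊎ x ≡ x₀ → Lonely y ⊎ y ≡ x₀ → σ x ≡ σ y → x ≡ y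
    injective (inj₁ (x∈X , ¬Cx)) qy                 σx≡σy = alone x∈X (∈X qy) ¬Cx σx≡σy
    injective qx                 (inj₁ (y∈X , ¬Cy)) σx≡σy = sym (alone y∈X (∈X qx) ¬Cy (sym σx≡σy))
    injective (inj₂ refl)        (inj₂ refl)        _     = refl

  ∣S∣<∣X∣⇒0<#crowded : ∣ S ∣ < ∣ X ∣ → 0 < #crowded
  ∣S∣<∣X∣⇒0<#crowded ∣S∣<∣X∣ = +-cancelʳ-< ∣ S ∣ 0 #crowded (begin-strict
    ∣ S ∣               <⟨ ∣S∣<∣X∣ ⟩
    ∣ X ∣               ≡⟨ ∣X∣≡#crowded+#lonely ⟩
    #crowded + #lonely  ≤⟨ +-monoʳ-≤ #crowded #lonely≤∣S∣ ⟩
    #crowded + ∣ S ∣    ∎)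
    where open ≤-Reasoning

  ∣X∣+1∸∣S∣≤#crowded : ∣ S ∣ < ∣ X ∣ → ∣ X ∣ + 1 ∸ ∣ S ∣ ≤ #crowded
  ∣X∣+1∸∣S∣≤#crowded ∣S∣<∣X∣ with x₀ , x₀∈X , Cx₀ ← ∑𝟙-witness crowded? (∣S∣<∣X∣⇒0<#crowded ∣S∣<∣X∣) =
    m≤n+o⇒m∸n≤o _ ∣ S ∣ (begin
      ∣ X ∣ + 1                ≡⟨ cong (_+ 1) ∣X∣≡#crowded+#lonely ⟩
      #crowded + #lonely + 1   ≡⟨ +-assoc #crowded #lonely 1 ⟩
      #crowded + (#lonely + 1) ≤⟨ +-monoʳ-≤ #crowded (crowded⇒#lonely+1≤∣S∣ x₀∈X Cx₀) ⟩
      #crowded + ∣ S ∣         ≡⟨ +-comm #crowded ∣ S ∣ ⟩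
      ∣ S ∣ + #crowded         ∎)
    where open ≤-Reasoning

module _ {n T} (G : TemporalGraph n T) {t : Fin T} where

  Reach-++ : ∀ {u w v} → Reach G t u w → Reach G t w v → Reach G t u v
  Reach-++ here        r = r
  Reach-++ (step e r′) r = step e (Reach-++ r′ r)

  Reach-reverse : ∀ {u v} → Reach G t u v → Reach G t v u
  Reach-reverse here               = here
  Reach-reverse (step {u} {w} e r) = Reach-++ (Reach-reverse r) (step (trans (TemporalGraph.sym G t w u) e) here)

  Reach-exit : ∀ {ℓ} {L : Pred (Fin n) ℓ} → Decidable L → ∀ {u v} → L u → ¬ L v → Reach G t u v →
               ∃₂ λ a w → L a × ¬ L w × adj G t a w ≡ true
  Reach-exit L? Lu ¬Lv here = contradiction Lu ¬Lv
  Reach-exit L? Lu ¬Lv (step {w = w} e r) with L? w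
  ... | yes Lw = Reach-exit L? Lw ¬Lv r
  ... | no ¬Lw = _ , w , Lu , ¬Lw , e

sum-tabulate : ∀ {n} (f : Fin n → ℕ) → ℕ.sum (List.tabulate f) ≡ ∑[ i < n ] f i
sum-tabulate {zero}  f = refl
sum-tabulate {suc n} f = cong (f zero +_) (sum-tabulate (f ∘ suc))

sum-map-allFin : ∀ {n} (f : Fin n → ℕ) → ℕ.sum (List.map f (List.allFin n)) ≡ ∑[ i < n ] f i
sum-map-allFin f = trans (cong ℕ.sum (Listₚ.map-tabulate (λ i → i) f)) (sum-tabulate f)

module _ {n T} (G : TemporalGraph n T) where

  adjU : Fin n → Fin n → ℕ
  adjU u v = if underlyingAdj G u v then 1 else 0

  adj⇒underlyingAdj : ∀ {i u v} → adj G i u v ≡ true → underlyingAdj G u v ≡ true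
  adj⇒underlyingAdj {i} {u} {v} e = Equivalence.to Boolₚ.T-≡
    (any⁺ (λ t → adj G t u v) (Any.map (λ { refl → Equivalence.from Boolₚ.T-≡ e }) (∈-allFin i)))

  adj⇒1≤adjU : ∀ {i u v} → adj G i u v ≡ true → 1 ≤ adjU u v
  adj⇒1≤adjU e rewrite adj⇒underlyingAdj e = ≤-refl

  ∑∑adjU≡∑degU : ∀ (w : Fin n → ℕ) → ∑[ v < n ] ∑[ u < n ] (adjU u v * w u) ≡ ∑[ u < n ] (degU G u * w u)
  ∑∑adjU≡∑degU w = begin
    ∑[ v < n ] ∑[ u < n ] (adjU u v * w u) ≡⟨ ∑-comm (λ v u → adjU u v * w u) ⟩
    ∑[ u < n ] ∑[ v < n ] (adjU u v * w u) ≡⟨ sum-cong-≗ (λ u → sym (*-distribʳ-sum (w u) (adjU u))) ⟩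
    ∑[ u < n ] ((∑[ v < n ] adjU u v) * w u) ≡⟨ sum-cong-≗ (λ u → cong (_* w u) (sym (sum-map-allFin (adjU u)))) ⟩
    ∑[ u < n ] (degU G u * w u) ∎
    where open ≡-Reasoning

TWalkFrom-weaken : ∀ {n T} {G : TemporalGraph n T} {lb lb′ v u} → lb′ ≤ lb → TWalkFrom G lb v u → TWalkFrom G lb′ v u
TWalkFrom-weaken _      nil              = nil
TWalkFrom-weaken lb′≤lb (cons t lb≤t e w) = cons t (≤-trans lb′≤lb lb≤t) e w

module Journeys {n T} (G : TemporalGraph n T) where

  Edge : ℕ → Fin n → Fin n → Set
  Edge t u v = ∃[ i ] toℕ i ≡ t × adj G i u v ≡ true

  edge? : ∀ t u v → Dec (Edge t u v)
  edge? t u v = any? λ i → toℕ i ℕₚ.≟ t ×-dec adj G i u v Boolₚ.≟ true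

  Edge⇒< : ∀ {t u v} → Edge t u v → t < T
  Edge⇒< (i , refl , _) = Finₚ.toℕ<n i

  Edge-sym : ∀ {t u v} → Edge t u v → Edge t v u
  Edge-sym {u = u} {v} (i , i≡t , e) = i , i≡t , trans (TemporalGraph.sym G i v u) e

  -- Journey s k v u: a temporal walk from v to u whose times lie in [s, s + k).
  Journey : ℕ → ℕ → Fin n → Fin n → Set
  Journey s zero    v u = v ≡ u
  Journey s (suc k) v u = Journey (suc s) k v u ⊎ ∃[ w ] Edge s v w × Journey (suc s) k w u

  journey? : ∀ s k v u → Dec (Journey s k v u)
  journey? s zero    v u = v Finₚ.≟ u
  journey? s (suc k) v u = journey? (suc s) k v u ⊎-dec any? λ w → edge? s v w ×-dec journey? (suc s) k w u

  journey⇒walk : ∀ s k {v u} → Journey s k v u → TWalkFrom G s v u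
  journey⇒walk s zero    refl                            = nil
  journey⇒walk s (suc k) (inj₁ j)                        = TWalkFrom-weaken (n≤1+n s) (journey⇒walk (suc s) k j)
  journey⇒walk _ (suc k) (inj₂ (_ , (i , refl , e) , j)) = cons i ≤-refl e (journey⇒walk (suc (toℕ i)) k j)

  journey-refl : ∀ s k v → Journey s k v v
  journey-refl s zero    v = refl
  journey-refl s (suc k) v = inj₁ (journey-refl (suc s) k v)

  journey-edge : ∀ {s v w} → Edge s v w → Journey s 1 v w
  journey-edge e = inj₂ (_ , e , refl)

  journey-cast : ∀ {s s′ k v u} → s ≡ s′ → Journey s k v u → Journey s′ k v u
  journey-cast refl j = j

  journey-++ : ∀ s k {k′ v a u} → Journey s k v a → Journey (s + k) k′ a u → Journey s (k + k′) v u
  journey-++ s zero    refl               j′ = journey-cast (+-identityʳ s) j′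
  journey-++ s (suc k) (inj₁ j)           j′ = inj₁ (journey-++ (suc s) k j (journey-cast (+-suc s k) j′))
  journey-++ s (suc k) (inj₂ (w , e , j)) j′ = inj₂ (w , e , journey-++ (suc s) k j (journey-cast (+-suc s k) j′))

  journey-or-separated : (X : Subset n) →
                         (∃[ x ] ∃[ y ] x ∈ X × y ∈ X × x ≢ y × Journey 0 T x y) ⊎
                         (∀ {x y} → x ∈ X → y ∈ X → Journey 0 T x y → x ≡ y)
  journey-or-separated X
    with any? (λ x → any? (λ y → x ∈? X ×-dec y ∈? X ×-dec ¬? (x Finₚ.≟ y) ×-dec journey? 0 T x y))
  ... | yes found = inj₁ found
  ... | no ∄journey = inj₂ separated
    where
    separated : ∀ {x y} → x ∈ X → y ∈ X → Journey 0 T x y → x ≡ y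
    separated {x} {y} x∈X y∈X j with x Finₚ.≟ y
    ... | yes x≡y = x≡y
    ... | no x≢y  = contradiction (x , y , x∈X , y∈X , x≢y , j) ∄journey

  Before : ℕ → Fin n → Fin n → Set
  Before t = Journey 0 t

  After : ℕ → Fin n → Fin n → Set
  After t = Journey t (T ∸ t)

  module _ {t : ℕ} where

    Before-mono : ∀ {x v} → Before t x v → Before (suc t) x v
    Before-mono {x} {v} j = subst (λ k → Before k x v) (+-comm t 1) (journey-++ 0 t j (journey-refl t 1 v))

    Before-step : ∀ {x a b} → Before t x a → Edge t a b → Before (suc t) x b
    Before-step {x} {b = b} j e = subst (λ k → Before k x b) (+-comm t 1) (journey-++ 0 t j (journey-edge e))

    After-mono : ∀ {v x} → After (suc t) v x → After t v x
    After-mono {v} {x} j with t <? T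
    ... | yes t<T = subst (λ k → Journey t k v x) (sym (+-∸-assoc 1 t<T)) (inj₁ j)
    ... | no t≮T  = subst (λ k → Journey t k v x) (sym (m≤n⇒m∸n≡0 T≤t))
                      (subst (λ k → Journey (suc t) k v x) (m≤n⇒m∸n≡0 (m≤n⇒m≤1+n T≤t)) j)
      where T≤t = ≮⇒≥ t≮T

    After-step : ∀ {a b x} → Edge t a b → After (suc t) b x → After t a x
    After-step {a} {b} {x} e j = subst (λ k → Journey t k a x) (sym (+-∸-assoc 1 (Edge⇒< e))) (inj₂ (b , e , j))

    Before-After⇒Journey : t ≤ T → ∀ {x v y} → Before t x v → After t v y → Journey 0 T x y
    Before-After⇒Journey t≤T {x} {y = y} j j′ = subst (λ k → Journey 0 k x y) (m+[n∸m]≡n t≤T) (journey-++ 0 t j j′)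

module Separated {n T} (G : TemporalGraph n T) (X : Subset n)
  (separated : ∀ {x y} → x ∈ X → y ∈ X → Journeys.Journey G 0 T x y → x ≡ y) where

  open Journeys G

  meet : ∀ {t x v y} → t ≤ T → x ∈ X → y ∈ X → Before t x v → After t v y → x ≡ y
  meet t≤T x∈X y∈X j j′ = separated x∈X y∈X (Before-After⇒Journey t≤T j j′)

  Claims : ℕ → Fin n → Fin n → Set
  Claims t x a = Before t x a × After (suc t) a x

  claims? : ∀ t x a → Dec (Claims t x a)
  claims? t x a = journey? 0 t x a ×-dec journey? (suc t) (T ∸ suc t) a x

  claims-unique : ∀ {t x y a} → t < T → x ∈ X → y ∈ X → Claims t x a → Claims t y a → x ≡ y
  claims-unique t<T x∈X y∈X (xa , _) (_ , ay) = meet (<⇒≤ t<T) x∈X y∈X xa (After-mono ay)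

  Reached : ℕ → Fin n → Set
  Reached t b = ∃[ x ] x ∈ X × Before t x b

  Returns : ℕ → Fin n → Set
  Returns t b = ∃[ x ] x ∈ X × After t b x

  reached? : ∀ t b → Dec (Reached t b)
  reached? t b = any? λ x → x ∈? X ×-dec journey? 0 t x b

  returns? : ∀ t b → Dec (Returns t b)
  returns? t b = any? λ x → x ∈? X ×-dec journey? t (T ∸ t) b x

  Transition : ℕ → Fin n → Set
  Transition t b = (Reached (suc t) b × ¬ Reached t b) ⊎ (Returns t b × ¬ Returns (suc t) b)

  transition? : ∀ t b → Dec (Transition t b)
  transition? t b = (reached? (suc t) b ×-dec ¬? (reached? t b)) ⊎-dec (returns? t b ×-dec ¬? (returns? (suc t) b))

  Charged : ℕ → Fin n → Set
  Charged t x = ∃[ a ] Claims t x a × ∃[ b ] Edge t a b × Transition t b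

  charged? : ∀ t x → Dec (Charged t x)
  charged? t x = any? λ a → claims? t x a ×-dec any? λ b → edge? t a b ×-dec transition? t b

  boundary-transition : ∀ {t x a w} → x ∈ X → Claims t x a → Edge t a w → ¬ Claims t x w → Transition t w
  boundary-transition {t} {x} {a} {w} x∈X (xa , ax) e ¬xw with reached? t w
  ... | no ¬reached = inj₁ ((x , x∈X , Before-step xa e) , ¬reached)
  ... | yes (y , y∈X , yw) = inj₂ ((x , x∈X , After-step (Edge-sym e) ax) , stops-returning)
    where
    -- A journey from w back to X after t must end at x (x reaches w by time t + 1), and
    -- then y = x, so x would claim w.
    stops-returning : ¬ Returns (suc t) w
    stops-returning (z , z∈X , wz) with meet (Edge⇒< e) x∈X z∈X (Before-step xa e) wz
    ... | refl with meet (<⇒≤ (Edge⇒< e)) y∈X x∈X yw (After-mono wz)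
    ... | refl = ¬xw (yw , wz)

  claims-refl : ∀ t x → Claims t x x
  claims-refl t x = journey-refl 0 t x , journey-refl (suc t) (T ∸ suc t) x

  claims∈X⇒≡ : ∀ {t x y} → t < T → x ∈ X → y ∈ X → Claims t x y → x ≡ y
  claims∈X⇒≡ {t} {y = y} t<T x∈X y∈X (xy , _) =
    meet t<T x∈X y∈X (Before-mono xy) (journey-refl (suc t) (T ∸ suc t) y)

  Reach⇒Charged : ∀ (i : Fin T) {x y} → x ∈ X → y ∈ X → x ≢ y → Reach G i x y → Charged (toℕ i) x
  Reach⇒Charged i {x} x∈X y∈X x≢y r
    with a , w , xa , ¬xw , e ← Reach-exit G (claims? (toℕ i) x) (claims-refl (toℕ i) x)
                                  (x≢y ∘ claims∈X⇒≡ (Finₚ.toℕ<n i) x∈X y∈X) r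
    = a , xa , w , edge , boundary-transition x∈X xa edge ¬xw
    where edge = i , refl , e

  #charged : ℕ → ℕ
  #charged t = ∑[ x < n ] 𝟙 (x ∈? X ×-dec charged? t x)

  #charged≤ : ∀ {t} → t < T → #charged t ≤ ∑[ b < n ] (degU G b * 𝟙 (transition? t b))
  #charged≤ {t} t<T = ≤-trans
    (∑𝟙-owners (λ x → x ∈? X ×-dec charged? t x) (claims? t) transitionDegree
      owns (λ (x∈X , _) (y∈X , _) → claims-unique t<T x∈X y∈X))
    (≤-reflexive (∑∑adjU≡∑degU G (𝟙 ∘ transition? t)))
    where
    transitionDegree : Fin n → ℕ
    transitionDegree a = ∑[ b < n ] (adjU G b a * 𝟙 (transition? t b))
    owns : ∀ {x} → x ∈ X × Charged t x → ∃[ a ] Claims t x a × 1 ≤ transitionDegree a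
    owns (_ , a , xa , b , e , tr) with i , refl , eᵢ ← Edge-sym e =
      a , xa , ≤-trans (*-mono-≤ (adj⇒1≤adjU G eᵢ) (1≤𝟙 (transition? t b) tr)) (∑-single _ b)

  transitions≤2 : ∀ b → ∑[ i < T ] 𝟙 (transition? (toℕ i) b) ≤ 2
  transitions≤2 b = begin
    ∑[ i < T ] 𝟙 (transition? (toℕ i) b)                ≤⟨ ∑-mono-≤ {T} (λ i → 𝟙-⊎ (arrives? (toℕ i)) (leaves? (toℕ i))) ⟩
    ∑[ i < T ] (𝟙 (arrives? (toℕ i)) + 𝟙 (leaves? (toℕ i))) ≡⟨ ∑-distrib-+ {T} (𝟙 ∘ arrives? ∘ toℕ) (𝟙 ∘ leaves? ∘ toℕ) ⟩
    ∑[ i < T ] 𝟙 (arrives? (toℕ i)) + ∑[ i < T ] 𝟙 (leaves? (toℕ i))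
      ≤⟨ +-mono-≤ (≤-trans (∑-rises≤𝟙 (λ t → reached? t b) reached-mono T) (𝟙≤1 (¬? (reached? 0 b))))
                  (≤-trans (∑-falls≤𝟙 (λ t → returns? t b) returns-anti T) (𝟙≤1 (returns? 0 b))) ⟩
    2 ∎
    where
    open ≤-Reasoning
    arrives? : ∀ t → Dec (Reached (suc t) b × ¬ Reached t b)
    arrives? t = reached? (suc t) b ×-dec ¬? (reached? t b)
    leaves? : ∀ t → Dec (Returns t b × ¬ Returns (suc t) b)
    leaves? t = returns? t b ×-dec ¬? (returns? (suc t) b)
    reached-mono : ∀ {t} → Reached t b → Reached (suc t) b
    reached-mono (x , x∈X , xb) = x , x∈X , Before-mono xb
    returns-anti : ∀ {t} → Returns (suc t) b → Returns t b
    returns-anti (x , x∈X , bx) = x , x∈X , After-mono bx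

  ∑#charged≤2*degSum : ∑[ i < T ] #charged (toℕ i) ≤ 2 * degSum G
  ∑#charged≤2*degSum = begin
    ∑[ i < T ] #charged (toℕ i)                                 ≤⟨ ∑-mono-≤ (λ i → #charged≤ (Finₚ.toℕ<n i)) ⟩
    ∑[ i < T ] ∑[ b < n ] (degU G b * 𝟙 (transition? (toℕ i) b)) ≡⟨ ∑-comm {T} (λ i b → degU G b * 𝟙 (transition? (toℕ i) b)) ⟩
    ∑[ b < n ] ∑[ i < T ] (degU G b * 𝟙 (transition? (toℕ i) b)) ≡⟨ sum-cong-≗ (λ b → sym (*-distribˡ-sum (degU G b) (λ i → 𝟙 (transition? (toℕ {T} i) b)))) ⟩
    ∑[ b < n ] (degU G b * ∑[ i < T ] 𝟙 (transition? (toℕ i) b)) ≤⟨ ∑-mono-≤ (λ b → *-monoʳ-≤ (degU G b) (transitions≤2 b)) ⟩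
    ∑[ b < n ] (degU G b * 2)                                   ≡⟨ *-distribʳ-sum 2 (degU G) ⟨
    (∑[ b < n ] degU G b) * 2                                   ≡⟨ cong (_* 2) (sum-map-allFin (degU G)) ⟨
    degSum G * 2                                                ≡⟨ *-comm (degSum G) 2 ⟩
    2 * degSum G                                                ∎
    where open ≤-Reasoning

  #charged≥ : ∀ {S} → AlwaysConnected G S → ∣ S ∣ < ∣ X ∣ → ∀ i → ∣ X ∣ + 1 ∸ ∣ S ∣ ≤ #charged (toℕ i)
  #charged≥ {S} connected ∣S∣<∣X∣ i =
    Crowding.∣X∣+1∸∣S∣≤#crowded X S root (charged? (toℕ i)) (λ x → proj₁ (proj₂ (connected i x))) alone ∣S∣<∣X∣
    where
    root : Fin n → Fin n
    root x = proj₁ (connected i x)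
    root⇝ : ∀ x → Reach G i (root x) x
    root⇝ x = proj₂ (proj₂ (connected i x))
    alone : ∀ {x y} → x ∈ X → y ∈ X → ¬ Charged (toℕ i) x → root x ≡ root y → x ≡ y
    alone {x} {y} x∈X y∈X ¬charged rx≡ry with x Finₚ.≟ y
    ... | yes x≡y = x≡y
    ... | no x≢y  = contradiction (Reach⇒Charged i x∈X y∈X x≢y x⇝y) ¬charged
      where x⇝y = Reach-++ G (Reach-reverse G (root⇝ x)) (subst (λ u → Reach G i u y) (sym rx≡ry) (root⇝ y))

  T*[∣X∣+1∸∣S∣]≤2*degSum : ∀ {S} → AlwaysConnected G S → ∣ S ∣ < ∣ X ∣ → T * (∣ X ∣ + 1 ∸ ∣ S ∣) ≤ 2 * degSum G
  T*[∣X∣+1∸∣S∣]≤2*degSum connected ∣S∣<∣X∣ = ≤-trans (∑-lowerBound (#charged≥ connected ∣S∣<∣X∣)) ∑#charged≤2*degSum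

lemma4 : (n T : ℕ) (G : TemporalGraph n T) (S X : Subset n) →
    AlwaysConnected G S →
    suc ∣ S ∣ ≤ ∣ X ∣ →
    2 * degSum G + (∣ X ∣ + 1 ∸ ∣ S ∣) ≤ T * (∣ X ∣ + 1 ∸ ∣ S ∣) →
    ∃ λ v → ∃ λ u → v ∈ X × u ∈ X × ¬ (v ≡ u) × TemporalWalk G v u
lemma4 n T G S X connected ∣S∣<∣X∣ lifetime with Journeys.journey-or-separated G X
... | inj₁ (x , y , x∈X , y∈X , x≢y , j) = x , y , x∈X , y∈X , x≢y , Journeys.journey⇒walk G 0 T j
... | inj₂ separated = contradiction
  (≤-trans lifetime (Separated.T*[∣X∣+1∸∣S∣]≤2*degSum G X separated connected ∣S∣<∣X∣))
  (<⇒≱ (m<m+n (2 * degSum G) (m<n⇒0<n∸m (≤-trans ∣S∣<∣X∣ (m≤m+n ∣ X ∣ 1)))))
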